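{- Let $n\geqslant 3$ be an odd integer and $m\geqslant 1$ an integer, and let $C_n$ denote the cycle graph on $n$ vertices. The number $p(2m)$ of closed walks of length $2m$ on $C_n$ is $$p(2m)=\begin{cases}\displaystyle 2n\Bigl(\binom{2m-1}{m-1}+\sum_{r=1}^{\lfloor m/n\rfloor}\binom{2m}{m-rn}\Bigr), & m\geqslant n,\\[2mm] \displaystyle 2n\binom{2m-1}{m-1}, & m<n.\end{cases}$$
   Context: A walk of length $r$ in a graph is a sequence $(v_0,v_1,\dots,v_r)$ of vertices (not necessarily distinct) such that $v_{i-1}$ and $v_i$ are adjacent for each $i=1,\dots,r$; it is closed if $v_0=v_r$. The number of closed walks of length $r$ is the number of such sequences, i.e. the trace of $A^r$ where $A$ is the adjacency matrix. The cycle graph $C_n$ has vertices $0,1,\dots,n-1$ with $i$ adjacent to $j$ iff $i-j\equiv\pm1\pmod n$. $\lfloor x\rfloor$ is the floor of $x$. -}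

module Defs where

open import Data.Nat using (ℕ; zero; suc; _+_; _*_; _≡ᵇ_; _%_; NonZero)
open import Data.Nat.DivMod using (_/_)
open import Data.Nat.Combinatorics using (_C_)
open import Data.Fin using (Fin; toℕ)
open import Data.Bool using (Bool; true; false; _∨_; if_then_else_)
open import Data.List using (List; map; allFin; upTo)
open import Data.Nat.ListAction using (sum)

ΣFin : (n : ℕ) → (Fin n → ℕ) → ℕ
ΣFin n f = sum (map f (allFin n))

cycAdj : (n : ℕ) → Fin n → Fin n → ℕ
cycAdj zero    () _
cycAdj (suc k) i j =
  if ((toℕ j ≡ᵇ ((toℕ i + 1) % suc k)) ∨ (toℕ i ≡ᵇ ((toℕ j + 1) % suc k))) then 1 else 0

walks : (n : ℕ) → ℕ → Fin n → Fin n → ℕ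
walks n zero    v w = if toℕ v ≡ᵇ toℕ w then 1 else 0
walks n (suc r) v w = ΣFin n (λ u → cycAdj n v u * walks n r u w)

closedWalks : (n : ℕ) → ℕ → ℕ
closedWalks n r = ΣFin n (λ v → walks n r v v)

Σ1to : ℕ → (ℕ → ℕ) → ℕ
Σ1to k f = sum (map (λ i → f (suc i)) (upTo k))

private
  open import Relation.Binary.PropositionalEquality using (_≡_; refl)
  t1 : closedWalks 3 2 ≡ 6
  t1 = refl
  t2 : closedWalks 3 4 ≡ 18
  t2 = refl

{-# OPTIONS --safe #-}
-- Identify the vertices of C_n with ℤ/n. A walk of length r with t steps +1 and r − t steps −1
-- moves x to x + 2t − r, so there are Σ_t C(r,t) [x + 2t ≡ y + r] walks from x to y: this count
-- satisfies the recursion defining walks, by Pascal's rule. For odd n, 2 is invertible, so the closed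
-- walks of length 2m number n Σ_t C(2m,t) [t ≡ m]. The term t = m is C(2m,m) = 2 C(2m−1,m−1), and the
-- symmetry t ↦ 2m − t pairs the others into 2 Σ C(2m, m − s) over the multiples s = rn, 1 ≤ r ≤ ⌊m/n⌋.
module Submission where

open import Defs
open import Data.Bool using (Bool; true; false; if_then_else_; _∨_; T)
open import Data.Empty using (⊥; ⊥-elim)
open import Data.Fin as Fin using (Fin; toℕ)
open import Data.Fin.Properties using (toℕ<n)
open import Data.List using (map; applyUpTo; tabulate)
open import Data.List.Properties using (map-tabulate)
open import Data.Nat using (ℕ; zero; suc; _+_; _*_; _∸_; _≤_; _<_; NonZero; z≤n; s≤s; _≡ᵇ_)
open import Data.Nat.Combinatorics using (_C_; nCk≡nC[n∸k]; nCk+nC[k+1]≡[n+1]C[k+1]; k>n⇒nCk≡0)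
open import Data.Nat.DivMod
  using (_/_; _%_; %-distribˡ-+; %-distribˡ-*; [m+kn]%n≡m%n; [m+n]%n≡m%n; m%n%n≡m%n; m<n⇒m%n≡m;
         m%n<n; m≡m%n+[m/n]*n; m<n⇒m/n≡0)
open import Data.Nat.ListAction using (sum)
open import Data.Nat.Properties
open import Algebra.Properties.CommutativeSemigroup +-commutativeSemigroup
  using (interchange; x∙yz≈xz∙y; xy∙z≈xz∙y)
open import Data.Nat.Tactic.RingSolver using (solve-∀)
open import Data.Product using (Σ; _×_; _,_)
open import Function using (_∘_; id)
open import Function.Bundles using (mk⇔)
open import Relation.Binary.PropositionalEquality
  using (_≡_; refl; sym; trans; cong; cong₂; subst; subst₂; module ≡-Reasoning)
open import Relation.Nullary.Decidable using (does-⇔; dec-true)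

𝟙 : Bool → ℕ
𝟙 b = if b then 1 else 0

𝟙-∨ : ∀ a b → (T a → T b → ⊥) → 𝟙 (a ∨ b) ≡ 𝟙 a + 𝟙 b
𝟙-∨ true  true  disjoint = ⊥-elim (disjoint _ _)
𝟙-∨ true  false _        = refl
𝟙-∨ false b     _        = refl

Σ< : ℕ → (ℕ → ℕ) → ℕ
Σ< zero    f = 0
Σ< (suc k) f = f 0 + Σ< k (f ∘ suc)

Σ<-cong : ∀ k {f g : ℕ → ℕ} → (∀ i → i < k → f i ≡ g i) → Σ< k f ≡ Σ< k g
Σ<-cong zero    f≡g = refl
Σ<-cong (suc k) f≡g = cong₂ _+_ (f≡g 0 (s≤s z≤n)) (Σ<-cong k (λ i i<k → f≡g (suc i) (s≤s i<k)))

Σ<-distrib-+ : ∀ k (f g : ℕ → ℕ) → Σ< k (λ i → f i + g i) ≡ Σ< k f + Σ< k g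
Σ<-distrib-+ zero    f g = refl
Σ<-distrib-+ (suc k) f g = begin
  f 0 + g 0 + Σ< k (λ i → f (suc i) + g (suc i))   ≡⟨ cong (f 0 + g 0 +_) (Σ<-distrib-+ k (f ∘ suc) (g ∘ suc)) ⟩
  f 0 + g 0 + (Σ< k (f ∘ suc) + Σ< k (g ∘ suc))   ≡⟨ interchange (f 0) (g 0) _ _ ⟩
  f 0 + Σ< k (f ∘ suc) + (g 0 + Σ< k (g ∘ suc))   ∎
  where open ≡-Reasoning

Σ<-const : ∀ k c → Σ< k (λ _ → c) ≡ k * c
Σ<-const zero    c = refl
Σ<-const (suc k) c = cong (c +_) (Σ<-const k c)

Σ<-zero : ∀ k {f : ℕ → ℕ} → (∀ i → i < k → f i ≡ 0) → Σ< k f ≡ 0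
Σ<-zero k f≡0 = trans (Σ<-cong k f≡0) (trans (Σ<-const k 0) (*-zeroʳ k))

Σ<-++ : ∀ a b (f : ℕ → ℕ) → Σ< (a + b) f ≡ Σ< a f + Σ< b (λ i → f (a + i))
Σ<-++ zero    b f = refl
Σ<-++ (suc a) b f = trans (cong (f 0 +_) (Σ<-++ a b (f ∘ suc))) (sym (+-assoc (f 0) _ _))

Σ<-∷ʳ : ∀ k (f : ℕ → ℕ) → Σ< (suc k) f ≡ Σ< k f + f k
Σ<-∷ʳ k f = begin
  Σ< (suc k) f               ≡⟨ cong (λ j → Σ< j f) (+-comm 1 k) ⟩
  Σ< (k + 1) f               ≡⟨ Σ<-++ k 1 f ⟩
  Σ< k f + (f (k + 0) + 0)   ≡⟨ cong (Σ< k f +_) (trans (+-identityʳ _) (cong f (+-identityʳ k))) ⟩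
  Σ< k f + f k               ∎
  where open ≡-Reasoning

Σ<-reverse : ∀ k (f : ℕ → ℕ) → Σ< k f ≡ Σ< k (λ i → f (k ∸ suc i))
Σ<-reverse zero    f = refl
Σ<-reverse (suc k) f = begin
  f 0 + Σ< k (f ∘ suc)
    ≡⟨ cong (f 0 +_) (Σ<-reverse k (f ∘ suc)) ⟩
  f 0 + Σ< k (λ i → f (suc (k ∸ suc i)))
    ≡⟨ +-comm (f 0) _ ⟩
  Σ< k (λ i → f (suc (k ∸ suc i))) + f 0
    ≡⟨ cong₂ _+_ (Σ<-cong k (λ i i<k → cong f (sym (+-∸-assoc 1 i<k)))) (cong f (sym (n∸n≡0 k))) ⟩
  Σ< k (λ i → f (suc k ∸ suc i)) + f (suc k ∸ suc k)
    ≡⟨ Σ<-∷ʳ k (λ i → f (suc k ∸ suc i)) ⟨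
  Σ< (suc k) (λ i → f (suc k ∸ suc i))
    ∎
  where open ≡-Reasoning

Σ<-around : ∀ m (f : ℕ → ℕ) →
  Σ< (suc (2 * m)) f ≡ Σ< m (λ i → f (m ∸ suc i)) + f m + Σ< m (λ i → f (m + suc i))
Σ<-around m f = begin
  Σ< (suc (2 * m)) f                  ≡⟨ cong (λ j → Σ< j f) (1+2m≡m+[1+m] m) ⟩
  Σ< (m + suc m) f                    ≡⟨ Σ<-++ m (suc m) f ⟩
  Σ< m f + (f (m + 0) + above)        ≡⟨ cong₂ (λ a b → a + (f b + above)) (Σ<-reverse m f) (+-identityʳ m) ⟩
  below + (f m + above)               ≡⟨ +-assoc below (f m) above ⟨
  below + f m + above                 ∎
  where
  open ≡-Reasoning
  below above : ℕ
  below = Σ< m (λ i → f (m ∸ suc i))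
  above = Σ< m (λ i → f (m + suc i))
  1+2m≡m+[1+m] : ∀ m → suc (2 * m) ≡ m + suc m
  1+2m≡m+[1+m] = solve-∀

Σ<-select : ∀ k a (f : ℕ → ℕ) → a < k → Σ< k (λ i → 𝟙 (i ≡ᵇ a) * f i) ≡ f a
Σ<-select (suc k) zero    f _         = trans (cong (f 0 + 0 +_) (Σ<-zero k (λ _ _ → refl)))
                                              (trans (+-identityʳ _) (+-identityʳ _))
Σ<-select (suc k) (suc a) f (s≤s a<k) = Σ<-select k a (f ∘ suc) a<k

ΣFin≡Σ< : ∀ n (f : Fin n → ℕ) (g : ℕ → ℕ) → (∀ v → f v ≡ g (toℕ v)) → ΣFin n f ≡ Σ< n g
ΣFin≡Σ< n f g f≡g = trans (cong sum (map-tabulate id f)) (sum-tabulate n f g f≡g)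
  where
  sum-tabulate : ∀ n (f : Fin n → ℕ) (g : ℕ → ℕ) → (∀ v → f v ≡ g (toℕ v)) → sum (tabulate f) ≡ Σ< n g
  sum-tabulate zero    f g f≡g = refl
  sum-tabulate (suc n) f g f≡g = cong₂ _+_ (f≡g Fin.zero) (sum-tabulate n (f ∘ Fin.suc) (g ∘ suc) (f≡g ∘ Fin.suc))

Σ1to≡Σ< : ∀ k (f : ℕ → ℕ) → Σ1to k f ≡ Σ< k (f ∘ suc)
Σ1to≡Σ< k f = sum-applyUpTo k (f ∘ suc) id
  where
  sum-applyUpTo : ∀ k (f φ : ℕ → ℕ) → sum (map f (applyUpTo φ k)) ≡ Σ< k (f ∘ φ)
  sum-applyUpTo zero    f φ = refl
  sum-applyUpTo (suc k) f φ = cong (f (φ 0) +_) (sum-applyUpTo k f (φ ∘ suc))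

Σ<-pascal : ∀ r (f : ℕ → ℕ) → Σ< (suc (suc r)) (λ t → (suc r C t) * f t)
          ≡ Σ< (suc r) (λ t → (r C t) * f t) + Σ< (suc r) (λ t → (r C t) * f (suc t))
Σ<-pascal r f = begin
  1 * f 0 + Σ< (suc r) (λ t → (suc r C suc t) * f (suc t))
    ≡⟨ cong (1 * f 0 +_) (Σ<-cong (suc r) (λ t _ → pascal t)) ⟩
  1 * f 0 + Σ< (suc r) (λ t → lower t + upper t)
    ≡⟨ cong (1 * f 0 +_) (Σ<-distrib-+ (suc r) lower upper) ⟩
  1 * f 0 + (Σ< (suc r) lower + Σ< (suc r) upper)
    ≡⟨ cong (λ s → 1 * f 0 + (Σ< (suc r) lower + s)) upper-top-vanishes ⟩
  1 * f 0 + (Σ< (suc r) lower + Σ< r upper)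
    ≡⟨ x∙yz≈xz∙y (1 * f 0) (Σ< (suc r) lower) (Σ< r upper) ⟩
  1 * f 0 + Σ< r upper + Σ< (suc r) lower
    ∎
  where
  open ≡-Reasoning
  lower upper : ℕ → ℕ
  lower t = (r C t) * f (suc t)
  upper t = (r C suc t) * f (suc t)
  pascal : ∀ t → (suc r C suc t) * f (suc t) ≡ lower t + upper t
  pascal t = trans (cong (_* f (suc t)) (sym (nCk+nC[k+1]≡[n+1]C[k+1] r t)))
                   (*-distribʳ-+ (f (suc t)) (r C t) (r C suc t))
  upper-top-vanishes : Σ< (suc r) upper ≡ Σ< r upper
  upper-top-vanishes = begin
    Σ< (suc r) upper                    ≡⟨ Σ<-∷ʳ r upper ⟩
    Σ< r upper + (r C suc r) * f (suc r) ≡⟨ cong (λ c → Σ< r upper + c * f (suc r)) (k>n⇒nCk≡0 (n<1+n r)) ⟩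
    Σ< r upper + 0                      ≡⟨ +-identityʳ (Σ< r upper) ⟩
    Σ< r upper                          ∎

central-binomial : ∀ m → (2 * suc m) C suc m ≡ 2 * ((2 * suc m ∸ 1) C m)
central-binomial m = begin
  suc p C suc m             ≡⟨ nCk+nC[k+1]≡[n+1]C[k+1] p m ⟨
  p C m + p C suc m         ≡⟨ cong (p C m +_) symmetric ⟩
  p C m + p C m             ≡⟨ cong (p C m +_) (+-identityʳ (p C m)) ⟨
  2 * (p C m)               ∎
  where
  open ≡-Reasoning
  p = 2 * suc m ∸ 1
  p≡m+[1+m] : p ≡ m + suc m
  p≡m+[1+m] = cong (λ j → m + suc j) (+-identityʳ m)
  symmetric : p C suc m ≡ p C m
  symmetric = begin
    p C suc m          ≡⟨ nCk≡nC[n∸k] (subst (suc m ≤_) (sym p≡m+[1+m]) (m≤n+m (suc m) m)) ⟩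
    p C (p ∸ suc m)    ≡⟨ cong (λ j → p C (j ∸ suc m)) p≡m+[1+m] ⟩
    p C (m + suc m ∸ suc m) ≡⟨ cong (p C_) (m+n∸n≡m m (suc m)) ⟩
    p C m              ∎

module Modulo (k : ℕ) where

  n : ℕ
  n = suc k

  infix 4 _≈_
  record _≈_ (a b : ℕ) : Set where
    constructor mk≈
    field ≈⇒%≡ : a % n ≡ b % n
  open _≈_

  ≈-sym : ∀ {a b} → a ≈ b → b ≈ a
  ≈-sym (mk≈ e) = mk≈ (sym e)

  ≈-trans : ∀ {a b c} → a ≈ b → b ≈ c → a ≈ c
  ≈-trans (mk≈ e) (mk≈ f) = mk≈ (trans e f)

  ≡⇒≈ : ∀ {a b} → a ≡ b → a ≈ b
  ≡⇒≈ refl = mk≈ refl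

  %-≈ : ∀ a → a % n ≈ a
  %-≈ a = mk≈ (m%n%n≡m%n a n)

  +n-≈ : ∀ a → a + n ≈ a
  +n-≈ a = mk≈ ([m+n]%n≡m%n a n)

  +-congʳ-≈ : ∀ {a b} c → a ≈ b → a + c ≈ b + c
  +-congʳ-≈ {a} {b} c (mk≈ e) = mk≈ (begin
    (a + c) % n                 ≡⟨ %-distribˡ-+ a c n ⟩
    (a % n + c % n) % n         ≡⟨ cong (λ z → (z + c % n) % n) e ⟩
    (b % n + c % n) % n         ≡⟨ %-distribˡ-+ b c n ⟨
    (b + c) % n                 ∎)
    where open ≡-Reasoning

  +-congˡ-≈ : ∀ {a b} c → a ≈ b → c + a ≈ c + b
  +-congˡ-≈ {a} {b} c a≈b = subst₂ _≈_ (+-comm a c) (+-comm b c) (+-congʳ-≈ c a≈b)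

  *-congˡ-≈ : ∀ {a b} c → a ≈ b → c * a ≈ c * b
  *-congˡ-≈ {a} {b} c (mk≈ e) = mk≈ (begin
    (c * a) % n                 ≡⟨ %-distribˡ-* c a n ⟩
    (c % n * (a % n)) % n       ≡⟨ cong (λ z → (c % n * z) % n) e ⟩
    (c % n * (b % n)) % n       ≡⟨ %-distribˡ-* c b n ⟨
    (c * b) % n                 ∎)
    where open ≡-Reasoning

  -- Adding c * k = c * (n - 1) undoes adding c.
  +-cancelʳ-≈ : ∀ {a b} c → a + c ≈ b + c → a ≈ b
  +-cancelʳ-≈ {a} {b} c a+c≈b+c = ≈-trans (≈-sym (undo a)) (≈-trans (+-congʳ-≈ (c * k) a+c≈b+c) (undo b))
    where
    undo : ∀ x → x + c + c * k ≈ x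
    undo x = mk≈ (trans (cong (_% n) (trans (+-assoc x c (c * k)) (cong (x +_) (sym (*-suc c k)))))
                        ([m+kn]%n≡m%n x c n))

  +-cancelˡ-≈ : ∀ {a b} c → c + a ≈ c + b → a ≈ b
  +-cancelˡ-≈ {a} {b} c c+a≈c+b = +-cancelʳ-≈ c (subst₂ _≈_ (+-comm c a) (+-comm c b) c+a≈c+b)

  ≈⇒≡ : ∀ {a b} → a < n → b < n → a ≈ b → a ≡ b
  ≈⇒≡ a<n b<n (mk≈ e) = trans (sym (m<n⇒m%n≡m a<n)) (trans e (m<n⇒m%n≡m b<n))

  [_≈_] : ℕ → ℕ → ℕ
  [ a ≈ b ] = 𝟙 (a % n ≡ᵇ b % n)

  [≈]-cong : ∀ {a b c d} → (a ≈ b → c ≈ d) → (c ≈ d → a ≈ b) → [ a ≈ b ] ≡ [ c ≈ d ]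
  [≈]-cong {a} {b} {c} {d} to from =
    cong 𝟙 (does-⇔ (mk⇔ (≈⇒%≡ ∘ to ∘ mk≈) (≈⇒%≡ ∘ from ∘ mk≈)) (a % n ≟ b % n) (c % n ≟ d % n))

  [≈]-congˡ : ∀ {a a′} b → a ≈ a′ → [ a ≈ b ] ≡ [ a′ ≈ b ]
  [≈]-congˡ {a} {a′} b a≈a′ = [≈]-cong {a} {b} {a′} {b} (≈-trans (≈-sym a≈a′)) (≈-trans a≈a′)

  [≈]-refl : ∀ a → [ a ≈ a ] ≡ 1
  [≈]-refl a = cong 𝟙 (dec-true (a % n ≟ a % n) refl)

  [≈]-sym : ∀ a b → [ a ≈ b ] ≡ [ b ≈ a ]
  [≈]-sym a b = [≈]-cong {a} {b} {b} {a} ≈-sym ≈-sym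

  [≈]-reduced : ∀ {y} a → y < n → [ y ≈ a ] ≡ 𝟙 (y ≡ᵇ a % n)
  [≈]-reduced {y} a y<n = cong 𝟙 (does-⇔ (mk⇔ (trans (sym (m<n⇒m%n≡m y<n))) (trans (m<n⇒m%n≡m y<n)))
                                          (y % n ≟ a % n) (y ≟ a % n))

  [≈]-shift : ∀ a s → [ a ≈ a + s ] ≡ [ s ≈ 0 ]
  [≈]-shift a s = [≈]-cong (λ a≈a+s → ≈-sym (+-cancelˡ-≈ a (≈-trans (≡⇒≈ (+-identityʳ a)) a≈a+s)))
                           (λ s≈0 → ≈-trans (≡⇒≈ (sym (+-identityʳ a))) (+-congˡ-≈ a (≈-sym s≈0)))

  Σ<-[≈]-select : ∀ a (f : ℕ → ℕ) → (∀ {x y} → x ≈ y → f x ≡ f y) → Σ< n (λ y → [ y ≈ a ] * f y) ≡ f a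
  Σ<-[≈]-select a f f-resp-≈ = begin
    Σ< n (λ y → [ y ≈ a ] * f y)             ≡⟨ Σ<-cong n (λ y y<n → cong (_* f y) ([≈]-reduced a y<n)) ⟩
    Σ< n (λ y → 𝟙 (y ≡ᵇ a % n) * f y)        ≡⟨ Σ<-select n (a % n) f (m%n<n a n) ⟩
    f (a % n)                                ≡⟨ f-resp-≈ (%-≈ a) ⟩
    f a                                      ∎
    where open ≡-Reasoning

  -- t steps +1 and r − t steps −1 lead from x to x + 2t − r; the congruence avoids the subtraction.
  binomialWalks : ℕ → ℕ → ℕ → ℕ
  binomialWalks r x y = Σ< (suc r) (λ t → (r C t) * [ x + 2 * t ≈ y + r ])

  binomialWalks-congˡ : ∀ r {x x′} y → x ≈ x′ → binomialWalks r x y ≡ binomialWalks r x′ y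
  binomialWalks-congˡ r y x≈x′ =
    Σ<-cong (suc r) (λ t _ → cong ((r C t) *_) ([≈]-congˡ (y + r) (+-congʳ-≈ (2 * t) x≈x′)))

  [≈]-cancelʳ : ∀ a b c → [ a + c ≈ b + c ] ≡ [ a ≈ b ]
  [≈]-cancelʳ a b c = [≈]-cong {a + c} {b + c} {a} {b} (+-cancelʳ-≈ c) (+-congʳ-≈ c)

  -- Adding k is subtracting 1 modulo n.
  [≈]-+k : ∀ a b → [ a + k ≈ b ] ≡ [ a ≈ b + 1 ]
  [≈]-+k a b = [≈]-cong {a + k} {b} {a} {b + 1}
    (λ a+k≈b → ≈-trans (≈-sym (+n-≈ a)) (≈-trans (≡⇒≈ (sym a+k+1≡a+n)) (+-congʳ-≈ 1 a+k≈b)))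
    (λ a≈b+1 → ≈-trans (+-congʳ-≈ k a≈b+1) (≈-trans (≡⇒≈ (+-assoc b 1 k)) (+n-≈ b)))
    where
    a+k+1≡a+n : a + k + 1 ≡ a + n
    a+k+1≡a+n = trans (+-assoc a k 1) (cong (a +_) (+-comm k 1))

  binomialWalks-step : ∀ r x y → binomialWalks r (x + 1) y + binomialWalks r (x + k) y ≡ binomialWalks (suc r) x y
  binomialWalks-step r x y = begin
    binomialWalks r (x + 1) y + binomialWalks r (x + k) y
      ≡⟨ +-comm (binomialWalks r (x + 1) y) _ ⟩
    binomialWalks r (x + k) y + binomialWalks r (x + 1) y
      ≡⟨ cong₂ _+_ (Σ<-cong (suc r) (λ t _ → cong ((r C t) *_) (step-down t)))
                   (Σ<-cong (suc r) (λ t _ → cong ((r C t) *_) (step-up t))) ⟩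
    Σ< (suc r) (λ t → (r C t) * I t) + Σ< (suc r) (λ t → (r C t) * I (suc t))
      ≡⟨ Σ<-pascal r I ⟨
    binomialWalks (suc r) x y
      ∎
    where
    open ≡-Reasoning
    I : ℕ → ℕ
    I t = [ x + 2 * t ≈ y + suc r ]
    y+r+1≡y+[1+r] : y + r + 1 ≡ y + suc r
    y+r+1≡y+[1+r] = trans (+-assoc y r 1) (cong (y +_) (+-comm r 1))
    step-down : ∀ t → [ x + k + 2 * t ≈ y + r ] ≡ I t
    step-down t = begin
      [ x + k + 2 * t ≈ y + r ]   ≡⟨ cong [_≈ y + r ] (xy∙z≈xz∙y x k (2 * t)) ⟩
      [ x + 2 * t + k ≈ y + r ]   ≡⟨ [≈]-+k (x + 2 * t) (y + r) ⟩
      [ x + 2 * t ≈ y + r + 1 ]   ≡⟨ cong [ x + 2 * t ≈_] y+r+1≡y+[1+r] ⟩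
      I t                         ∎
    step-up : ∀ t → [ x + 1 + 2 * t ≈ y + r ] ≡ I (suc t)
    step-up t = begin
      [ x + 1 + 2 * t ≈ y + r ]          ≡⟨ [≈]-cancelʳ (x + 1 + 2 * t) (y + r) 1 ⟨
      [ x + 1 + 2 * t + 1 ≈ y + r + 1 ]  ≡⟨ cong₂ [_≈_] (x+1+2t+1≡x+2[1+t] x t) y+r+1≡y+[1+r] ⟩
      I (suc t)                          ∎
      where
      x+1+2t+1≡x+2[1+t] : ∀ x t → x + 1 + 2 * t + 1 ≡ x + 2 * suc t
      x+1+2t+1≡x+2[1+t] = solve-∀

  cycAdj-split : 2 ≤ k → ∀ (v u : Fin n) → cycAdj n v u ≡ [ toℕ u ≈ toℕ v + 1 ] + [ toℕ u ≈ toℕ v + k ]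
  cycAdj-split 2≤k v u = begin
    𝟙 ((y ≡ᵇ (x + 1) % n) ∨ (x ≡ᵇ (y + 1) % n))
      ≡⟨ 𝟙-∨ (y ≡ᵇ (x + 1) % n) (x ≡ᵇ (y + 1) % n) not-both ⟩
    𝟙 (y ≡ᵇ (x + 1) % n) + 𝟙 (x ≡ᵇ (y + 1) % n)
      ≡⟨ cong₂ _+_ ([≈]-reduced (x + 1) (toℕ<n u)) ([≈]-reduced (y + 1) (toℕ<n v)) ⟨
    [ y ≈ x + 1 ] + [ x ≈ y + 1 ]
      ≡⟨ cong ([ y ≈ x + 1 ] +_) (trans (sym ([≈]-+k x y)) ([≈]-sym (x + k) y)) ⟩
    [ y ≈ x + 1 ] + [ y ≈ x + k ]
      ∎
    where
    open ≡-Reasoning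
    x = toℕ v
    y = toℕ u
    ≡ᵇ-% : ∀ a b → T (a ≡ᵇ b % n) → a ≈ b
    ≡ᵇ-% a b a≡ᵇb%n = ≈-trans (≡⇒≈ (≡ᵇ⇒≡ a (b % n) a≡ᵇb%n)) (%-≈ b)
    -- Both adjacencies would give x + 2 ≈ x, i.e. n ∣ 2.
    not-both : T (y ≡ᵇ (x + 1) % n) → T (x ≡ᵇ (y + 1) % n) → ⊥
    not-both y≈x+1 x≈y+1
      with ≈⇒≡ (s≤s z≤n) (s≤s 2≤k) (+-cancelˡ-≈ x (≈-trans (≡⇒≈ (+-identityʳ x)) x≈x+2))
      where
      x≈x+2 : x ≈ x + 2
      x≈x+2 = ≈-trans (≡ᵇ-% x (y + 1) x≈y+1)
                (≈-trans (+-congʳ-≈ 1 (≡ᵇ-% y (x + 1) y≈x+1)) (≡⇒≈ (+-assoc x 1 1)))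
    ... | ()

  walks≡binomialWalks : 2 ≤ k → ∀ r (v w : Fin n) → walks n r v w ≡ binomialWalks r (toℕ v) (toℕ w)
  walks≡binomialWalks _ zero v w = sym (begin
    1 * [ x + 0 ≈ y + 0 ] + 0   ≡⟨ trans (+-identityʳ _) (*-identityˡ _) ⟩
    [ x + 0 ≈ y + 0 ]           ≡⟨ cong₂ [_≈_] (+-identityʳ x) (+-identityʳ y) ⟩
    [ x ≈ y ]                   ≡⟨ [≈]-reduced y (toℕ<n v) ⟩
    𝟙 (x ≡ᵇ y % n)              ≡⟨ cong (λ z → 𝟙 (x ≡ᵇ z)) (m<n⇒m%n≡m (toℕ<n w)) ⟩
    𝟙 (x ≡ᵇ y)                  ∎)
    where
    open ≡-Reasoning
    x = toℕ v
    y = toℕ w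
  walks≡binomialWalks 2≤k (suc r) v w = begin
    ΣFin n (λ u → cycAdj n v u * walks n r u w)
      ≡⟨ ΣFin≡Σ< n _ (λ z → ([ z ≈ x + 1 ] + [ z ≈ x + k ]) * B z)
                      (λ u → cong₂ _*_ (cycAdj-split 2≤k v u) (walks≡binomialWalks 2≤k r u w)) ⟩
    Σ< n (λ z → ([ z ≈ x + 1 ] + [ z ≈ x + k ]) * B z)
      ≡⟨ Σ<-cong n (λ z _ → *-distribʳ-+ (B z) [ z ≈ x + 1 ] [ z ≈ x + k ]) ⟩
    Σ< n (λ z → [ z ≈ x + 1 ] * B z + [ z ≈ x + k ] * B z)
      ≡⟨ Σ<-distrib-+ n (λ z → [ z ≈ x + 1 ] * B z) (λ z → [ z ≈ x + k ] * B z) ⟩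
    Σ< n (λ z → [ z ≈ x + 1 ] * B z) + Σ< n (λ z → [ z ≈ x + k ] * B z)
      ≡⟨ cong₂ _+_ (Σ<-[≈]-select (x + 1) B (binomialWalks-congˡ r y))
                   (Σ<-[≈]-select (x + k) B (binomialWalks-congˡ r y)) ⟩
    B (x + 1) + B (x + k)
      ≡⟨ binomialWalks-step r x y ⟩
    binomialWalks (suc r) x y
      ∎
    where
    open ≡-Reasoning
    x = toℕ v
    y = toℕ w
    B : ℕ → ℕ
    B z = binomialWalks r z y

  binomialWalks-diagonal : ∀ r x → binomialWalks r x x ≡ binomialWalks r 0 0
  binomialWalks-diagonal r x = Σ<-cong (suc r) (λ t _ → cong ((r C t) *_)
    ([≈]-cong {x + 2 * t} {x + r} {2 * t} {r} (+-cancelˡ-≈ x) (+-congˡ-≈ x)))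

  closedWalks≡n*binomialWalks : 2 ≤ k → ∀ r → closedWalks n r ≡ n * binomialWalks r 0 0
  closedWalks≡n*binomialWalks 2≤k r = begin
    closedWalks n r                      ≡⟨ ΣFin≡Σ< n _ (λ x → binomialWalks r x x) (λ v → walks≡binomialWalks 2≤k r v v) ⟩
    Σ< n (λ x → binomialWalks r x x)     ≡⟨ Σ<-cong n (λ x _ → binomialWalks-diagonal r x) ⟩
    Σ< n (λ _ → binomialWalks r 0 0)     ≡⟨ Σ<-const n (binomialWalks r 0 0) ⟩
    n * binomialWalks r 0 0              ∎
    where open ≡-Reasoning

  -- Multiplication by j + 1 inverts 2, since 2 (j + 1) = n + 1.
  [≈]-halve : ∀ j → n ≡ 2 * j + 1 → ∀ a b → [ 2 * a ≈ 2 * b ] ≡ [ a ≈ b ]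
  [≈]-halve j n≡2j+1 a b = [≈]-cong {2 * a} {2 * b} {a} {b}
    (λ 2a≈2b → ≈-trans (≈-sym (halve a)) (≈-trans (*-congˡ-≈ (suc j) 2a≈2b) (halve b)))
    (*-congˡ-≈ 2)
    where
    [1+j]*[2*x]≡x+x*[2j+1] : ∀ j x → suc j * (2 * x) ≡ x + x * (2 * j + 1)
    [1+j]*[2*x]≡x+x*[2j+1] = solve-∀
    halve : ∀ x → suc j * (2 * x) ≈ x
    halve x = mk≈ (trans (cong (_% n) (trans ([1+j]*[2*x]≡x+x*[2j+1] j x) (cong (λ z → x + x * z) (sym n≡2j+1))))
                         ([m+kn]%n≡m%n x x n))

  binomialWalks-closed-odd : ∀ j → n ≡ 2 * j + 1 → ∀ m →
    binomialWalks (2 * m) 0 0 ≡ Σ< (suc (2 * m)) (λ t → ((2 * m) C t) * [ t ≈ m ])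
  binomialWalks-closed-odd j n≡2j+1 m =
    Σ<-cong (suc (2 * m)) (λ t _ → cong (((2 * m) C t) *_) ([≈]-halve j n≡2j+1 t m))

  Σ-binomial-≈-centre : ∀ m → Σ< (suc (2 * suc m)) (λ t → ((2 * suc m) C t) * [ t ≈ suc m ])
    ≡ 2 * ((2 * suc m ∸ 1) C m + Σ< (suc m) (λ i → ((2 * suc m) C (suc m ∸ suc i)) * [ suc i ≈ 0 ]))
  Σ-binomial-≈-centre m = begin
    Σ< (suc (2 * M)) f
      ≡⟨ Σ<-around M f ⟩
    Σ< M (λ i → f (M ∸ suc i)) + f M + Σ< M (λ i → f (M + suc i))
      ≡⟨ cong₂ _+_ (cong₂ _+_ (Σ<-cong M lower) centre) (Σ<-cong M upper) ⟩
    Σ< M g + 2 * X + Σ< M g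
      ≡⟨ regroup (Σ< M g) X ⟩
    2 * (X + Σ< M g)
      ∎
    where
    open ≡-Reasoning
    M = suc m
    X = (2 * M ∸ 1) C m
    f g : ℕ → ℕ
    f t = ((2 * M) C t) * [ t ≈ M ]
    g i = ((2 * M) C (M ∸ suc i)) * [ suc i ≈ 0 ]
    regroup : ∀ a b → a + 2 * b + a ≡ 2 * (b + a)
    regroup = solve-∀
    2M≡M+M : 2 * M ≡ M + M
    2M≡M+M = cong (M +_) (+-identityʳ M)
    centre : f M ≡ 2 * X
    centre = trans (cong (((2 * M) C M) *_) ([≈]-refl M)) (trans (*-identityʳ _) (central-binomial m))
    lower : ∀ i → i < M → f (M ∸ suc i) ≡ g i
    lower i i<M = cong (((2 * M) C (M ∸ suc i)) *_) (begin
      [ M ∸ suc i ≈ M ]                  ≡⟨ cong [ M ∸ suc i ≈_] (m∸n+n≡m i<M) ⟨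
      [ M ∸ suc i ≈ M ∸ suc i + suc i ]  ≡⟨ [≈]-shift (M ∸ suc i) (suc i) ⟩
      [ suc i ≈ 0 ]                      ∎)
    upper : ∀ i → i < M → f (M + suc i) ≡ g i
    upper i i<M = cong₂ _*_ reflect (trans ([≈]-sym (M + suc i) M) ([≈]-shift M (suc i)))
      where
      reflect : (2 * M) C (M + suc i) ≡ (2 * M) C (M ∸ suc i)
      reflect = begin
        (2 * M) C (M + suc i)                ≡⟨ nCk≡nC[n∸k] (subst (M + suc i ≤_) (sym 2M≡M+M) (+-monoʳ-≤ M i<M)) ⟩
        (2 * M) C (2 * M ∸ (M + suc i))      ≡⟨ cong (λ z → (2 * M) C (z ∸ (M + suc i))) 2M≡M+M ⟩
        (2 * M) C (M + M ∸ (M + suc i))      ≡⟨ cong ((2 * M) C_) ([m+n]∸[m+o]≡n∸o M M (suc i)) ⟩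
        (2 * M) C (M ∸ suc i)                ∎

  Σ<-multiples-blocks : ∀ q ρ (g : ℕ → ℕ) → ρ < n →
    Σ< (q * n + ρ) (λ i → g (suc i) * [ suc i ≈ 0 ]) ≡ Σ< q (λ j → g (suc j * n))
  Σ<-multiples-blocks zero ρ g ρ<n =
    Σ<-zero ρ (λ i i<ρ → trans (cong (g (suc i) *_) ([≈]-reduced 0 (≤-trans (s≤s i<ρ) ρ<n))) (*-zeroʳ (g (suc i))))
  Σ<-multiples-blocks (suc q) ρ g ρ<n = begin
    Σ< (n + q * n + ρ) h
      ≡⟨ cong (λ z → Σ< z h) (+-assoc n (q * n) ρ) ⟩
    Σ< (n + (q * n + ρ)) h
      ≡⟨ Σ<-++ n (q * n + ρ) h ⟩
    Σ< n h + Σ< (q * n + ρ) (λ i → h (n + i))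
      ≡⟨ cong₂ _+_ first-block (Σ<-cong (q * n + ρ) (λ i _ → shift i)) ⟩
    g (1 * n) + Σ< (q * n + ρ) (λ i → g (n + suc i) * [ suc i ≈ 0 ])
      ≡⟨ cong (g (1 * n) +_) (Σ<-multiples-blocks q ρ (λ s → g (n + s)) ρ<n) ⟩
    Σ< (suc q) (λ j → g (suc j * n))
      ∎
    where
    open ≡-Reasoning
    h : ℕ → ℕ
    h i = g (suc i) * [ suc i ≈ 0 ]
    first-block : Σ< n h ≡ g (1 * n)
    first-block = begin
      Σ< n h                  ≡⟨ Σ<-∷ʳ k h ⟩
      Σ< k h + g n * [ n ≈ 0 ] ≡⟨ cong₂ _+_ (Σ<-multiples-blocks zero k g (n<1+n k))
                                            (cong (g n *_) (trans ([≈]-congˡ 0 (+n-≈ 0)) ([≈]-refl 0))) ⟩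
      g n * 1                 ≡⟨ *-identityʳ (g n) ⟩
      g n                     ≡⟨ cong g (+-identityʳ n) ⟨
      g (1 * n)               ∎
    shift : ∀ i → h (n + i) ≡ g (n + suc i) * [ suc i ≈ 0 ]
    shift i = cong₂ _*_ (cong g (sym (+-suc n i)))
                        ([≈]-congˡ 0 (≈-trans (≡⇒≈ (trans (sym (+-suc n i)) (+-comm n (suc i)))) (+n-≈ (suc i))))

  Σ<-multiples : ∀ m (g : ℕ → ℕ) → Σ< m (λ i → g (suc i) * [ suc i ≈ 0 ]) ≡ Σ< (m / n) (λ j → g (suc j * n))
  Σ<-multiples m g = trans (cong (λ z → Σ< z (λ i → g (suc i) * [ suc i ≈ 0 ])) m≡[m/n]*n+m%n)
                           (Σ<-multiples-blocks (m / n) (m % n) g (m%n<n m n))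
    where
    m≡[m/n]*n+m%n : m ≡ m / n * n + m % n
    m≡[m/n]*n+m%n = trans (m≡m%n+[m/n]*n m n) (+-comm (m % n) _)

  closedWalks-even : 2 ≤ k → ∀ j → n ≡ 2 * j + 1 → ∀ m → closedWalks n (2 * suc m)
    ≡ n * (2 * ((2 * suc m ∸ 1) C m + Σ< (suc m / n) (λ i → (2 * suc m) C (suc m ∸ suc i * n))))
  closedWalks-even 2≤k j n≡2j+1 m = begin
    closedWalks n (2 * M)
      ≡⟨ closedWalks≡n*binomialWalks 2≤k (2 * M) ⟩
    n * binomialWalks (2 * M) 0 0
      ≡⟨ cong (n *_) (binomialWalks-closed-odd j n≡2j+1 M) ⟩
    n * Σ< (suc (2 * M)) (λ t → ((2 * M) C t) * [ t ≈ M ])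
      ≡⟨ cong (n *_) (Σ-binomial-≈-centre m) ⟩
    n * (2 * (X + Σ< M (λ i → ((2 * M) C (M ∸ suc i)) * [ suc i ≈ 0 ])))
      ≡⟨ cong (λ s → n * (2 * (X + s))) (Σ<-multiples M (λ s → (2 * M) C (M ∸ s))) ⟩
    n * (2 * (X + Σ< (M / n) (λ i → (2 * M) C (M ∸ suc i * n))))
      ∎
    where
    open ≡-Reasoning
    M = suc m
    X = (2 * M ∸ 1) C m

theorem5p2 : (n m : ℕ) → 3 ≤ n → (Σ ℕ λ k → n ≡ 2 * k + 1) → 1 ≤ m →
    .{{_ : NonZero n}} →
    ((n ≤ m → closedWalks n (2 * m) ≡
          2 * n * ((2 * m ∸ 1) C (m ∸ 1) + Σ1to (m / n) (λ r → (2 * m) C (m ∸ r * n))))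
      × (m < n → closedWalks n (2 * m) ≡ 2 * n * ((2 * m ∸ 1) C (m ∸ 1))))
theorem5p2 (suc k) (suc m) (s≤s 2≤k) (j , n≡2j+1) (s≤s z≤n) =
  (λ _ → formula) , λ M<n → trans formula (no-wraps M<n)
  where
  open Modulo k
  M = suc m
  X = (2 * M ∸ 1) C m
  F : ℕ → ℕ
  F r = (2 * M) C (M ∸ r * n)
  formula : closedWalks n (2 * M) ≡ 2 * n * (X + Σ1to (M / n) F)
  formula = begin
    closedWalks n (2 * M)                   ≡⟨ closedWalks-even 2≤k j n≡2j+1 m ⟩
    n * (2 * (X + Σ< (M / n) (F ∘ suc)))   ≡⟨ cong (λ s → n * (2 * (X + s))) (Σ1to≡Σ< (M / n) F) ⟨
    n * (2 * (X + Σ1to (M / n) F))         ≡⟨ n*[2*a]≡2*n*a n (X + Σ1to (M / n) F) ⟩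
    2 * n * (X + Σ1to (M / n) F)           ∎
    where
    open ≡-Reasoning
    n*[2*a]≡2*n*a : ∀ n a → n * (2 * a) ≡ 2 * n * a
    n*[2*a]≡2*n*a = solve-∀
  no-wraps : M < n → 2 * n * (X + Σ1to (M / n) F) ≡ 2 * n * X
  no-wraps M<n = cong (λ q → 2 * n * q) (trans (cong (λ q → X + Σ1to q F) (m<n⇒m/n≡0 M<n)) (+-identityʳ X))
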